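{- Let $r\geq 1$ be an integer, let $n=4r+11$, let $G=\mathbb{Z}/n\mathbb{Z}$, and let $A=\{0,1,\ldots,r+1\}\cup\{r+3,\,2r+6\}\subseteq G$ (elements taken modulo $n$). Then the minimal length of an arithmetic progression in $G$ containing $A$ is $2r+7$.
   Context: An arithmetic progression in $G$ with difference $d\in G$ is a set $\{a,a+d,\dots,a+(m-1)d\}$ with $a\in G$; its length is its number of elements. -}

module Defs where

open import Data.Nat using (ℕ; zero; suc; _+_; _*_; NonZero)
open import Data.Nat.DivMod using (_mod_)
open import Data.Fin using (Fin; toℕ)
open import Data.Fin.Subset using (Subset; ⊥; ⁅_⁆; _∪_)

-- The group G = ℤ/nℤ is represented by Fin n; the element with
-- representative k ∈ ℕ is  k mod n.

AP : (n : ℕ) .{{_ : NonZero n}} → Fin n → Fin n → ℕ → Subset n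
AP n a d zero    = ⊥
AP n a d (suc m) = ⁅ (toℕ a + m * toℕ d) mod n ⁆ ∪ AP n a d m

initSeg : (n : ℕ) .{{_ : NonZero n}} → ℕ → Subset n
initSeg n zero    = ⊥
initSeg n (suc k) = ⁅ k mod n ⁆ ∪ initSeg n k

modulus : ℕ → ℕ
modulus r = suc (4 * r + 10)

setA : (r : ℕ) → Subset (modulus r)
setA r = initSeg (modulus r) (r + 2)
       ∪ (⁅ (r + 3) mod modulus r ⁆ ∪ ⁅ (2 * r + 6) mod modulus r ⁆)

-- Suppose a progression a, a + d, …, a + (m − 1)d with m ≤ 2r + 6 terms covers A, and let u, v be
-- indices of the terms 0 and 1.  Then (v − u)d ≡ 1, so any w ∈ A occurs only at indices
-- ≡ u + w(v − u) (mod n).  Reversing the progression if necessary, v = u + k with k ≥ 0.  All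
-- indices are below 2r + 6 and sums of two of them stay below n, so the indices of 0, 1, …, r + 1
-- are exactly u, u + k, …, u + (r + 1)k; as the last is below 2r + 6 and k ≠ 0 (0 ≢ 1), this forces
-- k ≤ 3.  But then 2r + 6 (if k = 1) or r + 3 (if k = 2, 3) would need an index whose residue lies
-- in [2r + 6, n).  Conversely 0, 1, …, 2r + 6 is a progression of 2r + 7 distinct terms containing A.
-- A progression whose terms repeat is periodic, so it has as many distinct terms as some
-- repetition-free prefix; hence the bound on the number of terms is a bound on the cardinality.

module Submission where

open import Defs

module IntegerCongruence where

  open import Data.Nat.Base as ℕ using (ℕ; NonZero)
  import Data.Nat.Properties as ℕ
  open import Data.Nat.Divisibility as ℕ using (>⇒∤)
  open import Data.Nat.DivMod using (_%_; _/_; m≡m%n+[m/n]*n)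
  open import Data.Integer.Base using (ℤ; +_; _+_; _-_; _*_; -_; ∣_∣; _⊖_)
  open import Data.Integer.Properties
    using (pos-+; pos-*; +-injective; ∣i∣≡0⇒i≡0; i-j≡0⇒i≡j; m-n≡m⊖n; ∣m⊝n∣≤m⊔n; ⊖-≥)
  open import Data.Integer.Divisibility.Signed
    using (_∣_; divides; ∣⇒∣ᵤ; ∣m∣n⇒∣m+n; ∣m∣n⇒∣m-n; ∣m⇒∣-m; ∣n⇒∣m*n)
  open import Data.Integer.Tactic.RingSolver using (solve)
  open import Data.List.Base using ([]; _∷_)
  open import Relation.Binary.PropositionalEquality
  open import Relation.Nullary.Negation using (contradiction)

  infix 4 _≡_[mod_]

  record _≡_[mod_] (x y : ℤ) (n : ℕ) : Set where
    constructor congruent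
    field n∣x-y : + n ∣ x - y

  ≡[mod]-sym : ∀ {n x y} → x ≡ y [mod n ] → y ≡ x [mod n ]
  ≡[mod]-sym {n} {x} {y} (congruent n∣x-y) = congruent (subst (+ n ∣_) -[x-y]≡y-x (∣m⇒∣-m n∣x-y))
    where
    -[x-y]≡y-x : - (x - y) ≡ y - x
    -[x-y]≡y-x = solve (x ∷ y ∷ [])

  ≡[mod]-trans : ∀ {n x y z} → x ≡ y [mod n ] → y ≡ z [mod n ] → x ≡ z [mod n ]
  ≡[mod]-trans {n} {x} {y} {z} (congruent n∣x-y) (congruent n∣y-z) =
    congruent (subst (+ n ∣_) telescope (∣m∣n⇒∣m+n n∣x-y n∣y-z))
    where
    telescope : (x - y) + (y - z) ≡ x - z
    telescope = solve (x ∷ y ∷ z ∷ [])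

  m≡m%n[mod] : ∀ m n .{{_ : NonZero n}} → + m ≡ + (m % n) [mod n ]
  m≡m%n[mod] m n = congruent (divides (+ (m / n)) (begin
    + m - + (m % n)                          ≡⟨ cong (λ k → + k - + (m % n)) (m≡m%n+[m/n]*n m n) ⟩
    + (m % n ℕ.+ m / n ℕ.* n) - + (m % n)    ≡⟨ cong (_- + (m % n)) (pos-+ (m % n) (m / n ℕ.* n)) ⟩
    + (m % n) + + (m / n ℕ.* n) - + (m % n)  ≡⟨ cong (λ k → + (m % n) + k - + (m % n)) (pos-* (m / n) n) ⟩
    + (m % n) + + (m / n) * + n - + (m % n)  ≡⟨ cancel (+ (m % n)) (+ (m / n) * + n) ⟩
    + (m / n) * + n                          ∎))
    where
    open ≡-Reasoning
    cancel : ∀ i j → i + j - i ≡ j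
    cancel i j = solve (i ∷ j ∷ [])

  %-≡⇒≡[mod] : ∀ {m o n} .{{_ : NonZero n}} → m % n ≡ o % n → + m ≡ + o [mod n ]
  %-≡⇒≡[mod] {m} {o} {n} m%n≡o%n =
    ≡[mod]-trans (m≡m%n[mod] m n)
      (subst (λ k → + k ≡ + o [mod n ]) (sym m%n≡o%n) (≡[mod]-sym (m≡m%n[mod] o n)))

  private
    ∣∧<⇒≡0 : ∀ {n k} → n ℕ.∣ k → k ℕ.< n → k ≡ 0
    ∣∧<⇒≡0 {k = ℕ.zero}  _   _   = refl
    ∣∧<⇒≡0 {k = ℕ.suc _} n∣k k<n = contradiction n∣k (>⇒∤ k<n)

  ≡[mod]⇒≡ : ∀ {n x y} → x ℕ.< n → y ℕ.< n → + x ≡ + y [mod n ] → x ≡ y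
  ≡[mod]⇒≡ {n} {x} {y} x<n y<n (congruent n∣x-y) =
    +-injective (i-j≡0⇒i≡j (+ x) (+ y) (∣i∣≡0⇒i≡0 (∣∧<⇒≡0 (∣⇒∣ᵤ n∣x-y) ∣x-y∣<n)))
    where
    ∣x-y∣<n : ∣ + x - + y ∣ ℕ.< n
    ∣x-y∣<n = subst (ℕ._< n) (cong ∣_∣ (sym (m-n≡m⊖n x y)))
                (ℕ.≤-<-trans (∣m⊝n∣≤m⊔n x y) (ℕ.⊔-lub x<n y<n))

  -- With p, q, s the differences in the three hypotheses,
  -- c − (u + w (v − u)) = (c − u)(p − q) + (v − u)(s − p).
  affine-inverse : ∀ {n a d u v c w} →
    a + u * d ≡ + 0 [mod n ] → a + v * d ≡ + 1 [mod n ] → a + c * d ≡ w [mod n ] →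
    c ≡ u + w * (v - u) [mod n ]
  affine-inverse {n} {a} {d} {u} {v} {c} {w} (congruent p) (congruent q) (congruent s) =
    congruent (subst (+ n ∣_) combination
      (∣m∣n⇒∣m+n (∣n⇒∣m*n (c - u) (∣m∣n⇒∣m-n p q)) (∣n⇒∣m*n (v - u) (∣m∣n⇒∣m-n s p))))
    where
    combination : (c - u) * ((a + u * d - + 0) - (a + v * d - + 1))
                    + (v - u) * ((a + c * d - w) - (a + u * d - + 0))
                  ≡ c - (u + w * (v - u))
    combination = solve (a ∷ d ∷ u ∷ v ∷ c ∷ w ∷ [])

  record Occurrence (n : ℕ) (a d : ℤ) (m w : ℕ) : Set where
    constructor occurrence
    field
      index   : ℕ
      index<m : index ℕ.< m
      term≡w  : a + + index * d ≡ + w [mod n ]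

  open Occurrence public

  occurrence-from-% : ∀ {n a d m i w} .{{_ : NonZero n}} →
    i ℕ.< m → (a ℕ.+ i ℕ.* d) % n ≡ w % n → Occurrence n (+ a) (+ d) m w
  occurrence-from-% {n} {a} {d} {i = i} {w} i<m eq =
    occurrence i i<m (subst (_≡ + w [mod n ]) pos-a+id (%-≡⇒≡[mod] eq))
    where
    pos-a+id : + (a ℕ.+ i ℕ.* d) ≡ + a + + i * + d
    pos-a+id = trans (pos-+ a (i ℕ.* d)) (cong (λ x → + a + x) (pos-* i d))

  same-index⇒≡[mod] : ∀ {n a d m w w′} (o : Occurrence n a d m w) (o′ : Occurrence n a d m w′) →
    index o ≡ index o′ → + w ≡ + w′ [mod n ]
  same-index⇒≡[mod] (occurrence i _ p) (occurrence .i _ q) refl = ≡[mod]-trans (≡[mod]-sym p) q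

  index-linear : ∀ {n a d m w k} (o₀ : Occurrence n a d m 0) (o₁ : Occurrence n a d m 1) →
    index o₁ ≡ index o₀ ℕ.+ k → (o : Occurrence n a d m w) →
    + index o ≡ + (index o₀ ℕ.+ w ℕ.* k) [mod n ]
  index-linear {n} {a} {d} {w = w} {k} (occurrence u _ p) (occurrence _ _ q) refl (occurrence c _ s) =
    subst (+ c ≡_[mod n ]) u+w[v-u]≡u+wk (affine-inverse {a = a} {d} {+ u} {+ (u ℕ.+ k)} p q s)
    where
    open ≡-Reasoning
    cancel : ∀ i j l → i + j * (i + l - i) ≡ i + j * l
    cancel i j l = solve (i ∷ j ∷ l ∷ [])
    u+w[v-u]≡u+wk : + u + + w * (+ (u ℕ.+ k) - + u) ≡ + (u ℕ.+ w ℕ.* k)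
    u+w[v-u]≡u+wk = begin
      + u + + w * (+ (u ℕ.+ k) - + u)  ≡⟨ cong (λ x → + u + + w * (x - + u)) (pos-+ u k) ⟩
      + u + + w * (+ u + + k - + u)    ≡⟨ cancel (+ u) (+ w) (+ k) ⟩
      + u + + w * + k                  ≡⟨ cong (λ x → + u + x) (pos-* w k) ⟨
      + u + + (w ℕ.* k)                ≡⟨ pos-+ u (w ℕ.* k) ⟨
      + (u ℕ.+ w ℕ.* k)                ∎

  reverse : ∀ {n a d m w} → Occurrence n a d (ℕ.suc m) w → Occurrence n (a + + m * d) (- d) (ℕ.suc m) w
  reverse {n} {a} {d} {m} {w} (occurrence i i<1+m p) =
    occurrence (m ℕ.∸ i) (ℕ.s≤s (ℕ.m∸n≤m m i)) (subst (_≡ + w [mod n ]) reindex p)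
    where
    open ≡-Reasoning
    flip : ∀ x y j l → x + j * y ≡ x + l * y + (l - j) * - y
    flip x y j l = solve (x ∷ y ∷ j ∷ l ∷ [])
    reindex : a + + i * d ≡ a + + m * d + + (m ℕ.∸ i) * - d
    reindex = begin
      a + + i * d                      ≡⟨ flip a d (+ i) (+ m) ⟩
      a + + m * d + (+ m - + i) * - d  ≡⟨ cong (λ x → a + + m * d + x * - d) (m-n≡m⊖n m i) ⟩
      a + + m * d + (m ⊖ i) * - d      ≡⟨ cong (λ x → a + + m * d + x * - d) (⊖-≥ (ℕ.s≤s⁻¹ i<1+m)) ⟩
      a + + m * d + + (m ℕ.∸ i) * - d  ∎

open IntegerCongruence

open import Data.Nat using (ℕ; _≤_; _+_; _*_)
open import Data.Nat using (zero; suc; _<_; _∸_; z≤n; s≤s; s≤s⁻¹; NonZero; _≤?_; _<?_)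
open import Data.Nat.Properties
open import Data.Nat.DivMod using (_mod_; _%_; %-distribˡ-+)
open import Data.Nat.Tactic.RingSolver using (solve)
open import Data.Integer.Base as ℤ using (ℤ)
open import Data.Fin as Fin using (Fin; toℕ; fromℕ<)
open import Data.Fin.Properties using (toℕ-fromℕ<; toℕ-injective)
open import Data.Fin.Subset using (Subset; ⁅_⁆; _∪_; _∈_; _∉_; _⊆_; ∣_∣; inside; outside)
open import Data.Fin.Subset.Properties
  using (x∈⁅x⁆; x∈⁅y⁆⇒x≡y; p⊆p∪q; q⊆p∪q; x∈p∪q⁻; ∉⊥; ⊥⊆; ⊆-refl; ⊆-trans; _∈?_; ∪-identityˡ; ∣⊥∣≡0; p⊆q⇒∣p∣≤∣q∣)
open import Data.List.Base using ([]; _∷_)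
open import Data.Vec.Base as Vec using (here; there)
open import Data.Product using (_×_; Σ; ∃-syntax; _,_)
open import Data.Sum using (_⊎_; inj₁; inj₂)
open import Data.Empty using (⊥; ⊥-elim)
open import Function.Base using (_∘_)
open import Relation.Nullary using (yes; no)
open import Relation.Nullary.Negation using (contradiction)
open import Relation.Binary.PropositionalEquality
  using (_≡_; refl; sym; trans; cong; cong₂; subst; module ≡-Reasoning)

m+o≡n⇒m≤n : ∀ {m n} o → m + o ≡ n → m ≤ n
m+o≡n⇒m≤n {m} o refl = m≤m+n m o

mod≡⇒%≡ : ∀ x y {n} .{{_ : NonZero n}} → x mod n ≡ y mod n → x % n ≡ y % n
mod≡⇒%≡ _ _ eq = trans (sym (toℕ-fromℕ< _)) (trans (cong toℕ eq) (toℕ-fromℕ< _))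

mod-+-congʳ : ∀ {x y n} .{{_ : NonZero n}} z → x mod n ≡ y mod n → (x + z) mod n ≡ (y + z) mod n
mod-+-congʳ {x} {y} {n} z eq = toℕ-injective (begin
  toℕ ((x + z) mod n)      ≡⟨ toℕ-fromℕ< _ ⟩
  (x + z) % n              ≡⟨ %-distribˡ-+ x z n ⟩
  (x % n + z % n) % n      ≡⟨ cong (λ t → (t + z % n) % n) (mod≡⇒%≡ x y eq) ⟩
  (y % n + z % n) % n      ≡⟨ %-distribˡ-+ y z n ⟨
  (y + z) % n              ≡⟨ toℕ-fromℕ< _ ⟨
  toℕ ((y + z) mod n)      ∎)
  where open ≡-Reasoning

∣⁅x⁆∪p∣≡1+∣p∣ : ∀ {n} (x : Fin n) (p : Subset n) → x ∉ p → ∣ ⁅ x ⁆ ∪ p ∣ ≡ suc ∣ p ∣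
∣⁅x⁆∪p∣≡1+∣p∣ Fin.zero    (inside Vec.∷ p)  x∉p = contradiction here x∉p
∣⁅x⁆∪p∣≡1+∣p∣ Fin.zero    (outside Vec.∷ p) x∉p = cong (suc ∘ ∣_∣) (∪-identityˡ p)
∣⁅x⁆∪p∣≡1+∣p∣ (Fin.suc x) (inside Vec.∷ p)  x∉p = cong suc (∣⁅x⁆∪p∣≡1+∣p∣ x p (x∉p ∘ there))
∣⁅x⁆∪p∣≡1+∣p∣ (Fin.suc x) (outside Vec.∷ p) x∉p = ∣⁅x⁆∪p∣≡1+∣p∣ x p (x∉p ∘ there)

module Progression {n : ℕ} .{{_ : NonZero n}} (a d : Fin n) where

  term : ℕ → Fin n
  term i = (toℕ a + i * toℕ d) mod n

  term∈AP : ∀ {i m} → i < m → term i ∈ AP n a d m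
  term∈AP {i} {suc m} (s≤s i≤m) with m≤n⇒m<n∨m≡n i≤m
  ... | inj₁ i<m  = q⊆p∪q ⁅ term m ⁆ (AP n a d m) (term∈AP i<m)
  ... | inj₂ refl = p⊆p∪q (AP n a d i) (x∈⁅x⁆ (term i))

  ∈AP⇒term : ∀ {x} m → x ∈ AP n a d m → ∃[ i ] i < m × x ≡ term i
  ∈AP⇒term zero x∈AP = contradiction x∈AP ∉⊥
  ∈AP⇒term (suc m) x∈AP with x∈p∪q⁻ ⁅ term m ⁆ (AP n a d m) x∈AP
  ... | inj₁ x∈⁅tm⁆ = m , ≤-refl , x∈⁅y⁆⇒x≡y (term m) x∈⁅tm⁆
  ... | inj₂ x∈AP′ with ∈AP⇒term m x∈AP′
  ...   | i , i<m , x≡ti = i , m≤n⇒m≤1+n i<m , x≡ti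

  AP-mono : ∀ {k m} → k ≤ m → AP n a d k ⊆ AP n a d m
  AP-mono {k} k≤m x∈AP with ∈AP⇒term k x∈AP
  ... | i , i<k , refl = term∈AP (<-≤-trans i<k k≤m)

  term-shift : ∀ {i j} c → term j ≡ term i → term (j + c) ≡ term (i + c)
  term-shift {i} {j} c tj≡ti = begin
    term (j + c)                               ≡⟨ cong (_mod n) (regroup j) ⟩
    (toℕ a + j * toℕ d + c * toℕ d) mod n      ≡⟨ mod-+-congʳ (c * toℕ d) tj≡ti ⟩
    (toℕ a + i * toℕ d + c * toℕ d) mod n      ≡⟨ cong (_mod n) (regroup i) ⟨
    term (i + c)                               ∎
    where
    open ≡-Reasoning
    regroup : ∀ l → toℕ a + (l + c) * toℕ d ≡ toℕ a + l * toℕ d + c * toℕ d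
    regroup l = begin
      toℕ a + (l + c) * toℕ d              ≡⟨ cong (toℕ a +_) (*-distribʳ-+ (toℕ d) l c) ⟩
      toℕ a + (l * toℕ d + c * toℕ d)      ≡⟨ +-assoc (toℕ a) (l * toℕ d) (c * toℕ d) ⟨
      toℕ a + l * toℕ d + c * toℕ d        ∎

  -- Once a term repeats, every later term is an earlier one again.
  AP-periodic : ∀ {j} → term j ∈ AP n a d j → ∀ k → AP n a d k ⊆ AP n a d j
  AP-periodic _ zero = ⊥⊆
  AP-periodic {j} tj∈AP (suc k) y∈AP with x∈p∪q⁻ ⁅ term k ⁆ (AP n a d k) y∈AP
  ... | inj₂ y∈AP′ = AP-periodic {j} tj∈AP k y∈AP′
  ... | inj₁ y∈⁅tk⁆ = subst (_∈ AP n a d j) (sym (x∈⁅y⁆⇒x≡y (term k) y∈⁅tk⁆)) tk∈AP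
    where
    tk∈AP : term k ∈ AP n a d j
    tk∈AP with k <? j | ∈AP⇒term j tj∈AP
    ... | yes k<j | _ = term∈AP k<j
    ... | no k≮j | i , i<j , tj≡ti =
      subst (_∈ AP n a d j) tk≡t[i+c] (AP-periodic {j} tj∈AP k (term∈AP i+c<k))
      where
      c : ℕ
      c = k ∸ j
      j+c≡k : j + c ≡ k
      j+c≡k = m+[n∸m]≡n (≮⇒≥ k≮j)
      tk≡t[i+c] : term (i + c) ≡ term k
      tk≡t[i+c] = sym (trans (cong term (sym j+c≡k)) (term-shift {i} {j} c tj≡ti))
      i+c<k : i + c < k
      i+c<k = subst (i + c <_) j+c≡k (+-monoˡ-< c i<j)

  ∣AP∣≡m-or-repeat : ∀ m → ∣ AP n a d m ∣ ≡ m ⊎ ∃[ j ] j < m × term j ∈ AP n a d j × ∣ AP n a d j ∣ ≡ j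
  ∣AP∣≡m-or-repeat zero = inj₁ (∣⊥∣≡0 n)
  ∣AP∣≡m-or-repeat (suc m) with ∣AP∣≡m-or-repeat m
  ... | inj₂ (j , j<m , repeat) = inj₂ (j , m≤n⇒m≤1+n j<m , repeat)
  ... | inj₁ ∣AP∣≡m with term m ∈? AP n a d m
  ...   | yes tm∈AP = inj₂ (m , ≤-refl , tm∈AP , ∣AP∣≡m)
  ...   | no tm∉AP  = inj₁ (trans (∣⁅x⁆∪p∣≡1+∣p∣ (term m) (AP n a d m) tm∉AP) (cong suc ∣AP∣≡m))

  AP-shorten : ∀ m → ∃[ l ] l ≤ m × AP n a d m ⊆ AP n a d l × ∣ AP n a d l ∣ ≡ l
  AP-shorten m with ∣AP∣≡m-or-repeat m
  ... | inj₁ ∣AP∣≡m = m , ≤-refl , ⊆-refl , ∣AP∣≡m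
  ... | inj₂ (j , j<m , tj∈AP , ∣AP∣≡j) = j , <⇒≤ j<m , AP-periodic {j} tj∈AP m , ∣AP∣≡j

  ∣AP∣≤m : ∀ m → ∣ AP n a d m ∣ ≤ m
  ∣AP∣≤m m with AP-shorten m
  ... | l , l≤m , AP⊆ , ∣AP∣≡l = ≤-trans (p⊆q⇒∣p∣≤∣q∣ AP⊆) (≤-trans (≤-reflexive ∣AP∣≡l) l≤m)

  module _ {S : Subset n} {L : ℕ} (long : ∀ {m} → S ⊆ AP n a d m → L ≤ m) where

    ∣AP∣-bound : ∀ {m} → S ⊆ AP n a d m → L ≤ ∣ AP n a d m ∣
    ∣AP∣-bound {m} S⊆AP with AP-shorten m
    ... | l , l≤m , AP⊆ , ∣AP∣≡l =
      ≤-trans (subst (L ≤_) (sym ∣AP∣≡l) (long {l} (⊆-trans S⊆AP AP⊆))) (p⊆q⇒∣p∣≤∣q∣ (AP-mono l≤m))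

    ∣AP∣-exact : S ⊆ AP n a d L → ∣ AP n a d L ∣ ≡ L
    ∣AP∣-exact S⊆AP = ≤-antisym (∣AP∣≤m L) (∣AP∣-bound {L} S⊆AP)

open Progression

initSeg≡AP : ∀ {n} (d : Fin (suc n)) → toℕ d ≡ 1 → ∀ k → initSeg (suc n) k ≡ AP (suc n) Fin.zero d k
initSeg≡AP d _ zero = refl
initSeg≡AP {n} d d≡1 (suc k) = cong₂ (λ x p → ⁅ x mod suc n ⁆ ∪ p) k≡k*d (initSeg≡AP d d≡1 k)
  where
  k≡k*d : k ≡ k * toℕ d
  k≡k*d = trans (sym (*-identityʳ k)) (cong (k *_) (sym d≡1))

j∈initSeg : ∀ {n} .{{_ : NonZero n}} {j k} → j < k → j mod n ∈ initSeg n k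
j∈initSeg {n} {j} {suc k} (s≤s j≤k) with m≤n⇒m<n∨m≡n j≤k
... | inj₁ j<k  = q⊆p∪q ⁅ k mod n ⁆ (initSeg n k) (j∈initSeg j<k)
... | inj₂ refl = p⊆p∪q (initSeg n j) (x∈⁅x⁆ (j mod n))

∈initSeg⇒ : ∀ {n} .{{_ : NonZero n}} {x} k → x ∈ initSeg n k → ∃[ j ] j < k × x ≡ j mod n
∈initSeg⇒ zero x∈ = contradiction x∈ ∉⊥
∈initSeg⇒ {n} (suc k) x∈ with x∈p∪q⁻ ⁅ k mod n ⁆ (initSeg n k) x∈
... | inj₁ x∈⁅k⁆ = k , ≤-refl , x∈⁅y⁆⇒x≡y (k mod n) x∈⁅k⁆
... | inj₂ x∈′ with ∈initSeg⇒ k x∈′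
...   | j , j<k , x≡j = j , m≤n⇒m≤1+n j<k , x≡j

-- A as a set of naturals; setA r is its image in ℤ/(4r + 11).
data InA (r : ℕ) : ℕ → Set where
  segment : ∀ {j} → j ≤ suc r → InA r j
  near    : InA r (r + 3)
  far     : InA r (2 * r + 6)

0∈A : ∀ {r} → InA r 0
0∈A = segment z≤n

1∈A : ∀ {r} → InA r 1
1∈A = segment (s≤s z≤n)

Covers : ℕ → ℤ → ℤ → ℕ → Set
Covers r a d m = ∀ {w} → InA r w → Occurrence (modulus r) a d m w

index-sum<modulus : ∀ {r m x y} → m ≤ 2 * r + 6 → x < m → y < m → x + y < modulus r
index-sum<modulus {r} {m} {x} {y} m≤ x<m y<m = s≤s⁻¹ (begin
  suc (suc (x + y))       ≡⟨ cong suc (+-suc x y) ⟨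
  suc x + suc y           ≤⟨ +-mono-≤ (≤-trans x<m m≤) (≤-trans y<m m≤) ⟩
  2 * r + 6 + (2 * r + 6) ≡⟨ solve (r ∷ []) ⟩
  suc (suc (4 * r + 10))  ∎)
  where open ≤-Reasoning

1<modulus : ∀ r → 1 < modulus r
1<modulus r = s≤s (≤-trans (s≤s z≤n) (m≤n+m 10 (4 * r)))

OutOfRange : ℕ → ℕ → Set
OutOfRange r x = 2 * r + 6 ≤ x × x < modulus r

step-1-out-of-range : ∀ r u → u + suc r * 1 < 2 * r + 6 → OutOfRange r (u + (2 * r + 6) * 1)
step-1-out-of-range r u last = m+o≡n⇒m≤n u (solve (r ∷ u ∷ [])) , (begin-strict
  u + (2 * r + 6) * 1      ≡⟨ solve (r ∷ u ∷ []) ⟩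
  u + suc r * 1 + (r + 5)  <⟨ +-monoˡ-< (r + 5) last ⟩
  2 * r + 6 + (r + 5)      ≤⟨ m+o≡n⇒m≤n r (solve (r ∷ [])) ⟩
  suc (4 * r + 10)         ∎)
  where open ≤-Reasoning

step-2-out-of-range : ∀ r u → u + suc r * 2 < 2 * r + 6 → OutOfRange r (u + (r + 3) * 2)
step-2-out-of-range r u last = m+o≡n⇒m≤n u (solve (r ∷ u ∷ [])) , (begin-strict
  u + (r + 3) * 2      ≡⟨ solve (r ∷ u ∷ []) ⟩
  u + suc r * 2 + 4    <⟨ +-monoˡ-< 4 last ⟩
  2 * r + 6 + 4        ≤⟨ m+o≡n⇒m≤n (2 * r + 1) (solve (r ∷ [])) ⟩
  suc (4 * r + 10)     ∎)
  where open ≤-Reasoning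

step-3-out-of-range : ∀ r u → 1 ≤ r → u + suc r * 3 < 2 * r + 6 → OutOfRange r (u + (r + 3) * 3)
step-3-out-of-range r u 1≤r last = m+o≡n⇒m≤n (u + r + 3) (solve (r ∷ u ∷ [])) , (begin-strict
  u + (r + 3) * 3      ≡⟨ solve (r ∷ u ∷ []) ⟩
  u + suc r * 3 + 6    <⟨ +-monoˡ-< 6 last ⟩
  2 * r + 6 + 6        ≡⟨ solve (r ∷ []) ⟩
  2 * r + 10 + 2       ≤⟨ +-monoʳ-≤ (2 * r + 10) (*-monoʳ-≤ 2 1≤r) ⟩
  2 * r + 10 + 2 * r   ≡⟨ solve (r ∷ []) ⟩
  4 * r + 10           <⟨ n<1+n (4 * r + 10) ⟩
  suc (4 * r + 10)     ∎)
  where open ≤-Reasoning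

step≥4-overshoots : ∀ r u k → 1 ≤ r → 2 * r + 6 ≤ u + suc r * (4 + k)
step≥4-overshoots r u k 1≤r = begin
  2 * r + 6            ≡⟨ solve (r ∷ []) ⟩
  2 * r + 4 + 2        ≤⟨ +-monoʳ-≤ (2 * r + 4) (*-monoʳ-≤ 2 1≤r) ⟩
  2 * r + 4 + 2 * r    ≡⟨ solve (r ∷ []) ⟩
  suc r * 4            ≤⟨ *-monoʳ-≤ (suc r) (m≤m+n 4 k) ⟩
  suc r * (4 + k)      ≤⟨ m≤n+m (suc r * (4 + k)) u ⟩
  u + suc r * (4 + k)  ∎
  where open ≤-Reasoning

module Ascending {r : ℕ} {a d : ℤ} {m : ℕ} (m≤ : m ≤ 2 * r + 6)
  (cov : Covers r a d m) (k : ℕ) (step : index (cov 1∈A) ≡ index (cov 0∈A) + k) where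

  u : ℕ
  u = index (cov 0∈A)

  index<2r+6 : ∀ {w} (w∈ : InA r w) → index (cov w∈) < 2 * r + 6
  index<2r+6 w∈ = <-≤-trans (index<m (cov w∈)) m≤

  index<n : ∀ {w} (w∈ : InA r w) → index (cov w∈) < modulus r
  index<n w∈ = <-≤-trans (index<2r+6 w∈) (m+o≡n⇒m≤n (2 * r + 5) 2r+6+[2r+5]≡n)
    where
    2r+6+[2r+5]≡n : 2 * r + 6 + (2 * r + 5) ≡ suc (4 * r + 10)
    2r+6+[2r+5]≡n = solve (r ∷ [])

  k<m : k < m
  k<m = ≤-<-trans (m≤n+m k u) (subst (_< m) step (index<m (cov 1∈A)))

  linear : ∀ {w} (w∈ : InA r w) → ℤ.+ index (cov w∈) ≡ ℤ.+ (u + w * k) [mod modulus r ]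
  linear w∈ = index-linear (cov 0∈A) (cov 1∈A) step (cov w∈)

  -- Both sides of the congruence for the index of j + 1 are below n, so it is an equality.
  segment-index : ∀ {j} (j≤ : j ≤ suc r) → index (cov (segment j≤)) ≡ u + j * k
  segment-index z≤n = sym (+-identityʳ u)
  segment-index {suc j} 1+j≤ = ≡[mod]⇒≡ (index<n (segment 1+j≤)) next<n (linear (segment 1+j≤))
    where
    j≤ : j ≤ suc r
    j≤ = ≤-trans (n≤1+n j) 1+j≤
    next<n : u + suc j * k < modulus r
    next<n = subst (_< modulus r)
      (trans (cong (_+ k) (segment-index j≤)) (trans (+-assoc u (j * k) k) (cong (u +_) (+-comm (j * k) k))))
      (index-sum<modulus {r} m≤ (index<m (cov (segment j≤))) k<m)

  last-index : u + suc r * k < 2 * r + 6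
  last-index = subst (_< 2 * r + 6) (segment-index ≤-refl) (index<2r+6 (segment ≤-refl))

  unreachable : ∀ {w} (w∈ : InA r w) → OutOfRange r (u + w * k) → ⊥
  unreachable w∈ (2r+6≤ , <n) =
    <⇒≱ (index<2r+6 w∈) (subst (2 * r + 6 ≤_) (sym (≡[mod]⇒≡ (index<n w∈) <n (linear w∈))) 2r+6≤)

module _ {r : ℕ} {a d : ℤ} {m : ℕ} (1≤r : 1 ≤ r) (m≤ : m ≤ 2 * r + 6) (cov : Covers r a d m) where

  ascending-step-impossible : ∀ k → index (cov 1∈A) ≡ index (cov 0∈A) + k → ⊥
  ascending-step-impossible zero step =
    0≢1+n (≡[mod]⇒≡ (s≤s z≤n) (1<modulus r)
      (same-index⇒≡[mod] (cov 0∈A) (cov 1∈A) (sym (trans step (+-identityʳ _)))))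
  ascending-step-impossible 1 step = unreachable far (step-1-out-of-range r u last-index)
    where open Ascending m≤ cov 1 step
  ascending-step-impossible 2 step = unreachable near (step-2-out-of-range r u last-index)
    where open Ascending m≤ cov 2 step
  ascending-step-impossible 3 step = unreachable near (step-3-out-of-range r u 1≤r last-index)
    where open Ascending m≤ cov 3 step
  ascending-step-impossible (suc (suc (suc (suc k)))) step =
    <⇒≱ last-index (step≥4-overshoots r u k 1≤r)
    where open Ascending m≤ cov (4 + k) step

  ascending-impossible : index (cov 0∈A) ≤ index (cov 1∈A) → ⊥
  ascending-impossible u≤v = ascending-step-impossible _ (sym (m+[n∸m]≡n u≤v))

short-covers-impossible : ∀ {r a d m} → 1 ≤ r → m ≤ 2 * r + 6 → Covers r a d m → ⊥
short-covers-impossible {m = zero} _ _ cov = n≮0 (index<m (cov 0∈A))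
short-covers-impossible {m = suc m} 1≤r m≤ cov with ≤-total (index (cov 0∈A)) (index (cov 1∈A))
... | inj₁ u≤v = ascending-impossible 1≤r m≤ cov u≤v
... | inj₂ v≤u = ascending-impossible 1≤r m≤ (λ w∈ → reverse (cov w∈)) (∸-monoʳ-≤ m v≤u)

InA⇒∈setA : ∀ {r w} → InA r w → w mod modulus r ∈ setA r
InA⇒∈setA {r} (segment {j} j≤) = p⊆p∪q _ (j∈initSeg (subst (j <_) (sym (+-comm r 2)) (s≤s j≤)))
InA⇒∈setA {r} near = q⊆p∪q (initSeg (modulus r) (r + 2)) _ (p⊆p∪q _ (x∈⁅x⁆ _))
InA⇒∈setA {r} far  = q⊆p∪q (initSeg (modulus r) (r + 2)) _ (q⊆p∪q _ _ (x∈⁅x⁆ _))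

setA⊆initSeg : ∀ r → setA r ⊆ initSeg (modulus r) (2 * r + 7)
setA⊆initSeg r x∈A with x∈p∪q⁻ (initSeg (modulus r) (r + 2)) _ x∈A
... | inj₁ x∈seg with ∈initSeg⇒ (r + 2) x∈seg
...   | j , j<r+2 , refl = j∈initSeg (<-≤-trans j<r+2 (m+o≡n⇒m≤n (r + 5) r+2+[r+5]≡2r+7))
  where
  r+2+[r+5]≡2r+7 : r + 2 + (r + 5) ≡ 2 * r + 7
  r+2+[r+5]≡2r+7 = solve (r ∷ [])
setA⊆initSeg r x∈A | inj₂ x∈pts with x∈p∪q⁻ ⁅ (r + 3) mod modulus r ⁆ _ x∈pts
... | inj₁ x∈⁅r+3⁆  = subst (_∈ initSeg (modulus r) (2 * r + 7)) (sym (x∈⁅y⁆⇒x≡y _ x∈⁅r+3⁆))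
                        (j∈initSeg {j = r + 3} (m+o≡n⇒m≤n (r + 3) 1+r+3+[r+3]≡2r+7))
  where
  1+r+3+[r+3]≡2r+7 : suc (r + 3) + (r + 3) ≡ 2 * r + 7
  1+r+3+[r+3]≡2r+7 = solve (r ∷ [])
... | inj₂ x∈⁅2r+6⁆ = subst (_∈ initSeg (modulus r) (2 * r + 7)) (sym (x∈⁅y⁆⇒x≡y _ x∈⁅2r+6⁆))
                        (j∈initSeg {j = 2 * r + 6} (≤-reflexive (sym (+-suc (2 * r) 6))))

setA⊆AP⇒Covers : ∀ {r} {a d : Fin (modulus r)} {m} →
  setA r ⊆ AP (modulus r) a d m → Covers r (ℤ.+ toℕ a) (ℤ.+ toℕ d) m
setA⊆AP⇒Covers {a = a} {d} {m} A⊆AP {w} w∈A with ∈AP⇒term a d m (A⊆AP (InA⇒∈setA w∈A))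
... | i , i<m , w≡ti = occurrence-from-% i<m (sym (mod≡⇒%≡ w (toℕ a + i * toℕ d) w≡ti))

covering-length : ∀ {r} {a d : Fin (modulus r)} {m} → 1 ≤ r → setA r ⊆ AP (modulus r) a d m → 2 * r + 7 ≤ m
covering-length {r} {m = m} 1≤r A⊆AP with m ≤? 2 * r + 6
... | yes m≤ = ⊥-elim (short-covers-impossible 1≤r m≤ (setA⊆AP⇒Covers A⊆AP))
... | no m≰  = subst (_≤ m) (sym (+-suc (2 * r) 6)) (≰⇒> m≰)

proposition2p14 : (r : ℕ) → 1 ≤ r →
    ((a d : Fin (modulus r)) (m : ℕ) → setA r ⊆ AP (modulus r) a d m →
        2 * r + 7 ≤ ∣ AP (modulus r) a d m ∣)
    × Σ (Fin (modulus r)) (λ a → Σ (Fin (modulus r)) (λ d → Σ ℕ (λ m →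
        setA r ⊆ AP (modulus r) a d m × ∣ AP (modulus r) a d m ∣ ≡ 2 * r + 7)))
proposition2p14 r 1≤r =
  (λ a d m → ∣AP∣-bound a d (covering-length 1≤r) {m})
  , Fin.zero , one , 2 * r + 7 , A⊆AP , ∣AP∣-exact Fin.zero one (covering-length 1≤r) A⊆AP
  where
  one : Fin (modulus r)
  one = fromℕ< (1<modulus r)
  A⊆AP : setA r ⊆ AP (modulus r) Fin.zero one (2 * r + 7)
  A⊆AP = subst (setA r ⊆_) (initSeg≡AP one (toℕ-fromℕ< (1<modulus r)) (2 * r + 7)) (setA⊆initSeg r)
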